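{- Let $\mathcal{A}=\{A_0,A_1,A_2\}$ be the standard basis of a symmetric rank $3$ standard integral table algebra with character table $[1,k,\ell;\,1,r,-1-r;\,1,s,-1-s]$, and suppose $k=\ell$ and $s=-1-r$. Then $k=\ell=2(r+r^2)$, and each of the following $11$ partitions of $\{2,\dots,9\}$ gives a fusion of $\mathcal{A}\otimes\mathcal{A}$: $27|34|59|6|8$, $23|47|59|68$, $23|4579|68$, $2359|47|68$, $23|4678|59$, $2347|59|68$, $2368|47|59$, $234678|59$, $234579|68$, $2359|4678$, $2368|4579$.
   Context: A symmetric rank $3$ standard integral table algebra is a commutative associative complex algebra with basis $A_0=1,A_1,A_2$ such that the structure constants $\lambda_{ijh}$ ($A_iA_j=\sum_h\lambda_{ijh}A_h$) are nonnegative reals, $\lambda_{ij0}=0$ for $i\neq j$, and $\lambda_{ii0}=\delta(A_i)$ is a positive integer, where $\delta$ is the valency homomorphism. Main example: $A_0=I_n$, $A_1$ the adjacency matrix of a strongly regular graph, $A_2=J-I-A_1$. Here $k=\delta(A_1)$, $\ell=\delta(A_2)$, and the character table has rows the characters $\chi_0=\delta,\chi_1,\chi_2$ and columns $A_0,A_1,A_2$. The tensor square $\mathcal{A}\otimes\mathcal{A}$ has basis $A_{ij}=A_i\otimes A_j$, relabelled $C_{3j+i+1}=A_{ij}$: $C_1=A_{00},C_2=A_{10},C_3=A_{20},C_4=A_{01},C_5=A_{11},C_6=A_{21},C_7=A_{02},C_8=A_{12},C_9=A_{22}$. Partitions of $\{2,\dots,9\}$ are written with blocks separated by bars. A partition $\tau$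 gives a fusion of $\mathcal{A}\otimes\mathcal{A}$ if the span of $C_1$ and the block sums $\sum_{t\in T}C_t$ ($T$ a block of $\tau$) is closed under multiplication. -}

module Defs where

open import Data.Nat using (ℕ; zero; suc; _≡ᵇ_) renaming (_+_ to _+ℕ_; _*_ to _*ℕ_; _≥_ to _≥ℕ_)
open import Data.Fin using (Fin; zero; suc; toℕ)
open import Data.Bool using (Bool; true; false; if_then_else_)
open import Data.List using (List; []; _∷_)
open import Data.Bool.ListAction using (any)
open import Data.Product using (Σ; _×_; _,_)
open import Relation.Binary.PropositionalEquality using (_≡_)
open import Relation.Nullary using (¬_)
import Algebra.Structures as AS
import Relation.Binary.Structures as RS

record Reals : Set₁ where
  infixl 6 _+_
  infixl 7 _*_
  infix 4 _≤_
  field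
    R    : Set
    _+_  : R → R → R
    _*_  : R → R → R
    -_   : R → R
    0#   : R
    1#   : R
    _≤_  : R → R → Set
    isCommutativeRing : AS.IsCommutativeRing {A = R} _≡_ _+_ _*_ -_ 0# 1#
    0≢1  : ¬ (0# ≡ 1#)
    inverse : ∀ x → ¬ (x ≡ 0#) → Σ R (λ y → x * y ≡ 1#)
    isTotalOrder : RS.IsTotalOrder {A = R} _≡_ _≤_
    +-mono-≤ : ∀ x y z → x ≤ y → x + z ≤ y + z
    *-nonneg : ∀ x y → 0# ≤ x → 0# ≤ y → 0# ≤ x * y
    complete : (P : R → Set) → Σ R P → Σ R (λ b → ∀ x → P x → x ≤ b) →
               Σ R (λ s → (∀ x → P x → x ≤ s) × (∀ b → (∀ x → P x → x ≤ b) → s ≤ b))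

module _ (ℝ : Reals) where
  open Reals ℝ

  fromℕ : ℕ → R
  fromℕ zero    = 0#
  fromℕ (suc n) = 1# + fromℕ n

  sum3 : (Fin 3 → R) → R
  sum3 f = f zero + (f (suc zero) + f (suc (suc zero)))

  kron : Fin 3 → Fin 3 → R
  kron i j = if toℕ i ≡ᵇ toℕ j then 1# else 0#

  -- A symmetric rank 3 standard integral table algebra with standard
  -- basis A₀ = 1, A₁, A₂, given by its structure constants
  -- A_i A_j = Σ_h λ i j h A_h, together with its valency map δ.

  record TableAlgebra3 : Set where
    field
      λc       : Fin 3 → Fin 3 → Fin 3 → R
      nonneg   : ∀ i j h → 0# ≤ λc i j h
      unit     : ∀ j h → λc zero j h ≡ kron j h
      comm     : ∀ i j h → λc i j h ≡ λc j i h
      assoc    : ∀ i j m t →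
                 sum3 (λ h → λc i j h * λc h m t) ≡ sum3 (λ h → λc j m h * λc i h t)
      off-diag : ∀ i j → ¬ (toℕ i ≡ toℕ j) → λc i j zero ≡ 0#
      δ        : Fin 3 → ℕ
      δ-pos    : ∀ i → δ i ≥ℕ 1
      standard : ∀ i → λc i i zero ≡ fromℕ (δ i)
      δ-hom    : ∀ i j → fromℕ (δ i) * fromℕ (δ j) ≡ sum3 (λ h → λc i j h * fromℕ (δ h))

  module _ (𝒜 : TableAlgebra3) where
    open TableAlgebra3 𝒜

    IsCharacter : (Fin 3 → R) → Set
    IsCharacter χ = ∀ i j → χ i * χ j ≡ sum3 (λ h → λc i j h * χ h)

    row : R → Fin 3 → R
    row x zero = 1#
    row x (suc zero) = x
    row x (suc (suc zero)) = (- 1#) + (- x)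

    -- Character table [1,k,ℓ ; 1,r,-1-r ; 1,s,-1-s]: rows δ, χ₁, χ₂
    -- are (distinct) characters.
    HasCharTable : R → R → Set
    HasCharTable r s = IsCharacter (row r) × IsCharacter (row s) × ¬ (r ≡ s)

    -- Tensor square 𝒜 ⊗ 𝒜: elements are coefficient vectors over the
    -- basis A_ij = A_i ⊗ A_j, with C_{3j+i+1} = A_ij.

    Vec9 : Set
    Vec9 = Fin 3 → Fin 3 → R

    _⊙_ : Vec9 → Vec9 → Vec9
    (x ⊙ y) h h' = sum3 λ i → sum3 λ j → sum3 λ i' → sum3 λ j' →
                     x i j * y i' j' * (λc i i' h * λc j j' h')

    label : Fin 3 → Fin 3 → ℕ
    label i j = 3 *ℕ toℕ j +ℕ toℕ i +ℕ 1

    blockSum : List ℕ → Vec9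
    blockSum T i j = if any (λ t → t ≡ᵇ label i j) T then 1# else 0#

    InSpan : List Vec9 → Vec9 → Set
    InSpan []       v = ∀ i j → v i j ≡ 0#
    InSpan (w ∷ ws) v = Σ R (λ c → InSpan ws (λ i j → v i j + (- (c * w i j))))

    spanning : List (List ℕ) → List Vec9
    spanning []       = []
    spanning (T ∷ τ)  = blockSum T ∷ spanning τ

    IsFusion : List (List ℕ) → Set
    IsFusion τ = ∀ x y → InSpan S x → InSpan S y → InSpan S (x ⊙ y)
      where S = blockSum (1 ∷ []) ∷ spanning τ

paperPartitions : List (List (List ℕ))
paperPartitions =
    ((2 ∷ 7 ∷ []) ∷ (3 ∷ 4 ∷ []) ∷ (5 ∷ 9 ∷ []) ∷ (6 ∷ []) ∷ (8 ∷ []) ∷ [])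
  ∷ ((2 ∷ 3 ∷ []) ∷ (4 ∷ 7 ∷ []) ∷ (5 ∷ 9 ∷ []) ∷ (6 ∷ 8 ∷ []) ∷ [])
  ∷ ((2 ∷ 3 ∷ []) ∷ (4 ∷ 5 ∷ 7 ∷ 9 ∷ []) ∷ (6 ∷ 8 ∷ []) ∷ [])
  ∷ ((2 ∷ 3 ∷ 5 ∷ 9 ∷ []) ∷ (4 ∷ 7 ∷ []) ∷ (6 ∷ 8 ∷ []) ∷ [])
  ∷ ((2 ∷ 3 ∷ []) ∷ (4 ∷ 6 ∷ 7 ∷ 8 ∷ []) ∷ (5 ∷ 9 ∷ []) ∷ [])
  ∷ ((2 ∷ 3 ∷ 4 ∷ 7 ∷ []) ∷ (5 ∷ 9 ∷ []) ∷ (6 ∷ 8 ∷ []) ∷ [])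
  ∷ ((2 ∷ 3 ∷ 6 ∷ 8 ∷ []) ∷ (4 ∷ 7 ∷ []) ∷ (5 ∷ 9 ∷ []) ∷ [])
  ∷ ((2 ∷ 3 ∷ 4 ∷ 6 ∷ 7 ∷ 8 ∷ []) ∷ (5 ∷ 9 ∷ []) ∷ [])
  ∷ ((2 ∷ 3 ∷ 4 ∷ 5 ∷ 7 ∷ 9 ∷ []) ∷ (6 ∷ 8 ∷ []) ∷ [])
  ∷ ((2 ∷ 3 ∷ 5 ∷ 9 ∷ []) ∷ (4 ∷ 6 ∷ 7 ∷ 8 ∷ []) ∷ [])
  ∷ ((2 ∷ 3 ∷ 6 ∷ 8 ∷ []) ∷ (4 ∷ 5 ∷ 7 ∷ 9 ∷ []) ∷ [])
  ∷ []

{-# OPTIONS --safe #-}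
-- Both rows (1, r, -1-r) and (1, s, -1-s) are characters, so the character equations for
-- A₁A₁, A₁A₂ and A₂A₂ are quadratics with the two distinct roots r and s = -1 - r.  By Vieta
-- (root sum -1, root product -q with q = r + r²) and the valency equation
-- k² = k (1 + λ₁₁₁ + λ₁₁₂), every structure constant is an integer polynomial in q; in
-- particular k = ℓ = 2q.  Products in 𝒜 ⊗ 𝒜 are bilinear, so a partition gives a fusion as soon
-- as the product of any two block sums is again a combination of block sums; with the
-- structure constants known, these are finitely many identities between integer polynomials
-- in q, which are decided by normalising coefficient lists.
module Submission where

open import Algebra.Bundles using (CommutativeRing)
open import Algebra.Solver.Ring.AlmostCommutativeRing
  using (fromCommutativeRing; _-Raw-AlmostCommutative⟶_)
open import Data.Bool.Base using (Bool; true; false; if_then_else_)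
open import Data.Bool.ListAction using (any)
open import Data.Fin.Base using (Fin; zero; suc; toℕ)
open import Data.Fin.Properties using (sequence)
open import Data.Integer.Base as ℤ using (ℤ; +_; -[1+_]; 0ℤ; 1ℤ; -1ℤ; _⊖_; sign; ∣_∣; _◃_)
import Data.Integer.Properties as ℤₚ
open import Data.List.Base using (List; []; _∷_)
open import Data.List.Relation.Unary.All as All using (All; []; _∷_)
open import Data.Maybe.Base using (Maybe; just; map; zipWith; from-just)
open import Data.Maybe.Effectful using (applicative)
open import Data.Nat.Base as ℕ using (ℕ; zero; suc)
import Data.Nat.Properties as ℕₚ
open import Data.Product.Base using (_×_; _,_; proj₁; proj₂)
open import Data.Sign.Base as Sign using (Sign)
open import Data.Sum.Base using (inj₁; inj₂)
open import Function.Base using (_∘_)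
open import Level using (0ℓ)
open import Relation.Binary.PropositionalEquality.Core as ≡
  using (_≡_; _≢_; cong; cong₂; subst; subst₂)
import Relation.Binary.PropositionalEquality.Properties as ≡
open import Relation.Binary.Structures using (IsTotalOrder)
open import Relation.Nullary.Decidable.Core using (dec⇒maybe)

open import Defs hiding (sum3; Vec9; _⊙_; label; blockSum; InSpan; spanning; IsCharacter; row)
import Defs

Poly : Set
Poly = List ℤ

infixl 6 _+ᴾ_
infixl 7 _*ᴾ_ _·ᴾ_

_+ᴾ_ : Poly → Poly → Poly
[]      +ᴾ q       = q
(a ∷ p) +ᴾ []      = a ∷ p
(a ∷ p) +ᴾ (b ∷ q) = a ℤ.+ b ∷ p +ᴾ q

_·ᴾ_ : ℤ → Poly → Poly
a ·ᴾ []      = []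
a ·ᴾ (b ∷ p) = a ℤ.* b ∷ a ·ᴾ p

_*ᴾ_ : Poly → Poly → Poly
[]      *ᴾ q = []
(a ∷ p) *ᴾ q = a ·ᴾ q +ᴾ (0ℤ ∷ p *ᴾ q)

constᴾ : ℤ → Poly
constᴾ a = a ∷ []

Xᴾ : Poly
Xᴾ = 0ℤ ∷ 1ℤ ∷ []

indicatorᴾ : Bool → Poly
indicatorᴾ b = if b then constᴾ 1ℤ else []

module IntegerCoefficients {c ℓ} (R : CommutativeRing c ℓ) where
  open CommutativeRing R
  open import Algebra.Properties.Semiring.Mult.TCOptimised semiring
    using (1+×; ×-homo-+; ×1-homo-*) renaming (_×_ to _×′_)
  open import Algebra.Properties.Ring ring using (-1*x≈-x)
  open import Algebra.Properties.Group +-group using (ε⁻¹≈ε; ⁻¹-involutive)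
  open import Algebra.Properties.AbelianGroup +-abelianGroup using (⁻¹-∙-comm)
  open import Algebra.Properties.CommutativeSemigroup +-commutativeSemigroup
    using (interchange)
  open import Algebra.Properties.CommutativeSemigroup *-commutativeSemigroup
    using () renaming (interchange to *-interchange)
  open import Relation.Binary.Reasoning.Setoid setoid

  -- The optimised _×′_ makes ⟦ + 1 ⟧ℤ and ⟦ + 2 ⟧ℤ reduce to 1# and 1# + 1#, so solver
  -- constants match the way constants are written in goals.
  ⟦_⟧ℤ : ℤ → Carrier
  ⟦ + n ⟧ℤ      = n ×′ 1#
  ⟦ -[1+ n ] ⟧ℤ = - (suc n ×′ 1#)

  ⟦_⟧ₛ : Sign → Carrier
  ⟦ Sign.+ ⟧ₛ = 1#
  ⟦ Sign.- ⟧ₛ = - 1#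

  ⊖-homo : ∀ m n → ⟦ m ⊖ n ⟧ℤ ≈ m ×′ 1# - n ×′ 1#
  ⊖-homo m       zero    = sym (trans (+-congˡ ε⁻¹≈ε) (+-identityʳ _))
  ⊖-homo zero    (suc n) = sym (+-identityˡ _)
  ⊖-homo (suc m) (suc n) = begin
    ⟦ suc m ⊖ suc n ⟧ℤ                  ≈⟨ reflexive (cong ⟦_⟧ℤ (ℤₚ.[1+m]⊖[1+n]≡m⊖n m n)) ⟩
    ⟦ m ⊖ n ⟧ℤ                          ≈⟨ ⊖-homo m n ⟩
    m ×′ 1# - n ×′ 1#                   ≈⟨ +-identityˡ _ ⟨
    0# + (m ×′ 1# - n ×′ 1#)            ≈⟨ +-congʳ (-‿inverseʳ 1#) ⟨
    (1# - 1#) + (m ×′ 1# - n ×′ 1#)     ≈⟨ interchange 1# (- 1#) (m ×′ 1#) (- (n ×′ 1#)) ⟩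
    (1# + m ×′ 1#) + (- 1# - n ×′ 1#)   ≈⟨ +-congˡ (⁻¹-∙-comm 1# (n ×′ 1#)) ⟩
    (1# + m ×′ 1#) - (1# + n ×′ 1#)     ≈⟨ +-cong (1+× m 1#) (-‿cong (1+× n 1#)) ⟨
    suc m ×′ 1# - suc n ×′ 1#           ∎

  ⟦⟧ℤ-+-homo : ∀ i j → ⟦ i ℤ.+ j ⟧ℤ ≈ ⟦ i ⟧ℤ + ⟦ j ⟧ℤ
  ⟦⟧ℤ-+-homo (+ m)    (+ n)    = ×-homo-+ 1# m n
  ⟦⟧ℤ-+-homo (+ m)    -[1+ n ] = ⊖-homo m (suc n)
  ⟦⟧ℤ-+-homo -[1+ m ] (+ n)    = trans (⊖-homo n (suc m)) (+-comm _ _)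
  ⟦⟧ℤ-+-homo -[1+ m ] -[1+ n ] = begin
    - (suc (suc (m ℕ.+ n)) ×′ 1#)      ≈⟨ -‿cong (reflexive (cong (λ k → suc k ×′ 1#) (ℕₚ.+-suc m n))) ⟨
    - ((suc m ℕ.+ suc n) ×′ 1#)        ≈⟨ -‿cong (×-homo-+ 1# (suc m) (suc n)) ⟩
    - (suc m ×′ 1# + suc n ×′ 1#)      ≈⟨ ⁻¹-∙-comm _ _ ⟨
    - (suc m ×′ 1#) + - (suc n ×′ 1#)  ∎

  ⟦⟧ℤ-‿homo : ∀ i → ⟦ ℤ.- i ⟧ℤ ≈ - ⟦ i ⟧ℤ
  ⟦⟧ℤ-‿homo (+ zero)  = sym ε⁻¹≈ε
  ⟦⟧ℤ-‿homo (+ suc n) = refl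
  ⟦⟧ℤ-‿homo -[1+ n ]  = sym (⁻¹-involutive _)

  ⟦◃⟧ : ∀ s n → ⟦ s ◃ n ⟧ℤ ≈ ⟦ s ⟧ₛ * (n ×′ 1#)
  ⟦◃⟧ s      zero    = sym (zeroʳ _)
  ⟦◃⟧ Sign.+ (suc n) = sym (*-identityˡ _)
  ⟦◃⟧ Sign.- (suc n) = sym (-1*x≈-x _)

  ⟦⟧ₛ-*-homo : ∀ s t → ⟦ s Sign.* t ⟧ₛ ≈ ⟦ s ⟧ₛ * ⟦ t ⟧ₛ
  ⟦⟧ₛ-*-homo Sign.+ t      = sym (*-identityˡ _)
  ⟦⟧ₛ-*-homo Sign.- Sign.+ = sym (*-identityʳ _)
  ⟦⟧ₛ-*-homo Sign.- Sign.- = sym (trans (-1*x≈-x (- 1#)) (⁻¹-involutive 1#))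

  ⟦⟧ℤ≈sign*abs : ∀ i → ⟦ i ⟧ℤ ≈ ⟦ sign i ⟧ₛ * (∣ i ∣ ×′ 1#)
  ⟦⟧ℤ≈sign*abs i = trans (reflexive (cong ⟦_⟧ℤ (≡.sym (ℤₚ.signᵢ◃∣i∣≡i i)))) (⟦◃⟧ (sign i) ∣ i ∣)

  ⟦⟧ℤ-*-homo : ∀ i j → ⟦ i ℤ.* j ⟧ℤ ≈ ⟦ i ⟧ℤ * ⟦ j ⟧ℤ
  ⟦⟧ℤ-*-homo i j = begin
    ⟦ sign i Sign.* sign j ◃ ∣ i ∣ ℕ.* ∣ j ∣ ⟧ℤ
      ≈⟨ ⟦◃⟧ (sign i Sign.* sign j) (∣ i ∣ ℕ.* ∣ j ∣) ⟩
    ⟦ sign i Sign.* sign j ⟧ₛ * ((∣ i ∣ ℕ.* ∣ j ∣) ×′ 1#)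
      ≈⟨ *-cong (⟦⟧ₛ-*-homo (sign i) (sign j)) (×1-homo-* ∣ i ∣ ∣ j ∣) ⟩
    (⟦ sign i ⟧ₛ * ⟦ sign j ⟧ₛ) * ((∣ i ∣ ×′ 1#) * (∣ j ∣ ×′ 1#))
      ≈⟨ *-interchange _ _ _ _ ⟩
    (⟦ sign i ⟧ₛ * (∣ i ∣ ×′ 1#)) * (⟦ sign j ⟧ₛ * (∣ j ∣ ×′ 1#))
      ≈⟨ *-cong (⟦⟧ℤ≈sign*abs i) (⟦⟧ℤ≈sign*abs j) ⟨
    ⟦ i ⟧ℤ * ⟦ j ⟧ℤ ∎

  ⟦⟧ℤ-morphism : ℤ.+-*-rawRing -Raw-AlmostCommutative⟶ fromCommutativeRing R
  ⟦⟧ℤ-morphism = record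
    { ⟦_⟧    = ⟦_⟧ℤ
    ; +-homo = ⟦⟧ℤ-+-homo
    ; *-homo = ⟦⟧ℤ-*-homo
    ; -‿homo = ⟦⟧ℤ-‿homo
    ; 0-homo = refl
    ; 1-homo = refl
    }

  _≟⟦⟧ℤ_ : ∀ i j → Maybe (⟦ i ⟧ℤ ≈ ⟦ j ⟧ℤ)
  i ≟⟦⟧ℤ j = map (λ i≡j → reflexive (cong ⟦_⟧ℤ i≡j)) (dec⇒maybe (i ℤₚ.≟ j))

  open import Algebra.Solver.Ring ℤ.+-*-rawRing (fromCommutativeRing R) ⟦⟧ℤ-morphism _≟⟦⟧ℤ_ public
    using (solve; _:=_; _:+_; _:*_; _:-_; :-_; con)

  module Evaluation (x : Carrier) where

    ⟦_⟧ᴾ : Poly → Carrier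
    ⟦ [] ⟧ᴾ    = 0#
    ⟦ a ∷ p ⟧ᴾ = ⟦ a ⟧ℤ + x * ⟦ p ⟧ᴾ

    ⟦+ᴾ⟧ : ∀ p q → ⟦ p +ᴾ q ⟧ᴾ ≈ ⟦ p ⟧ᴾ + ⟦ q ⟧ᴾ
    ⟦+ᴾ⟧ []      q       = sym (+-identityˡ _)
    ⟦+ᴾ⟧ (a ∷ p) []      = sym (+-identityʳ _)
    ⟦+ᴾ⟧ (a ∷ p) (b ∷ q) = begin
      ⟦ a ℤ.+ b ⟧ℤ + x * ⟦ p +ᴾ q ⟧ᴾ
        ≈⟨ +-cong (⟦⟧ℤ-+-homo a b) (*-congˡ (⟦+ᴾ⟧ p q)) ⟩
      (⟦ a ⟧ℤ + ⟦ b ⟧ℤ) + x * (⟦ p ⟧ᴾ + ⟦ q ⟧ᴾ)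
        ≈⟨ solve 5 (λ A B X P Q → (A :+ B) :+ X :* (P :+ Q) := (A :+ X :* P) :+ (B :+ X :* Q))
                   refl ⟦ a ⟧ℤ ⟦ b ⟧ℤ x ⟦ p ⟧ᴾ ⟦ q ⟧ᴾ ⟩
      ⟦ a ∷ p ⟧ᴾ + ⟦ b ∷ q ⟧ᴾ ∎

    ⟦·ᴾ⟧ : ∀ a p → ⟦ a ·ᴾ p ⟧ᴾ ≈ ⟦ a ⟧ℤ * ⟦ p ⟧ᴾ
    ⟦·ᴾ⟧ a []      = sym (zeroʳ _)
    ⟦·ᴾ⟧ a (b ∷ p) = begin
      ⟦ a ℤ.* b ⟧ℤ + x * ⟦ a ·ᴾ p ⟧ᴾ
        ≈⟨ +-cong (⟦⟧ℤ-*-homo a b) (*-congˡ (⟦·ᴾ⟧ a p)) ⟩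
      ⟦ a ⟧ℤ * ⟦ b ⟧ℤ + x * (⟦ a ⟧ℤ * ⟦ p ⟧ᴾ)
        ≈⟨ solve 4 (λ A B X P → A :* B :+ X :* (A :* P) := A :* (B :+ X :* P))
                   refl ⟦ a ⟧ℤ ⟦ b ⟧ℤ x ⟦ p ⟧ᴾ ⟩
      ⟦ a ⟧ℤ * ⟦ b ∷ p ⟧ᴾ ∎

    ⟦*ᴾ⟧ : ∀ p q → ⟦ p *ᴾ q ⟧ᴾ ≈ ⟦ p ⟧ᴾ * ⟦ q ⟧ᴾ
    ⟦*ᴾ⟧ []      q = sym (zeroˡ _)
    ⟦*ᴾ⟧ (a ∷ p) q = begin
      ⟦ a ·ᴾ q +ᴾ (0ℤ ∷ p *ᴾ q) ⟧ᴾ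
        ≈⟨ ⟦+ᴾ⟧ (a ·ᴾ q) (0ℤ ∷ p *ᴾ q) ⟩
      ⟦ a ·ᴾ q ⟧ᴾ + (0# + x * ⟦ p *ᴾ q ⟧ᴾ)
        ≈⟨ +-cong (⟦·ᴾ⟧ a q) (+-congˡ (*-congˡ (⟦*ᴾ⟧ p q))) ⟩
      ⟦ a ⟧ℤ * ⟦ q ⟧ᴾ + (0# + x * (⟦ p ⟧ᴾ * ⟦ q ⟧ᴾ))
        ≈⟨ solve 4 (λ A Q X P → A :* Q :+ (con 0ℤ :+ X :* (P :* Q)) := (A :+ X :* P) :* Q)
                   refl ⟦ a ⟧ℤ ⟦ q ⟧ᴾ x ⟦ p ⟧ᴾ ⟩
      ⟦ a ∷ p ⟧ᴾ * ⟦ q ⟧ᴾ ∎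

    ⟦constᴾ⟧ : ∀ a → ⟦ constᴾ a ⟧ᴾ ≈ ⟦ a ⟧ℤ
    ⟦constᴾ⟧ a = trans (+-congˡ (zeroʳ x)) (+-identityʳ _)

    ⟦Xᴾ⟧ : ⟦ Xᴾ ⟧ᴾ ≈ x
    ⟦Xᴾ⟧ = solve 1 (λ X → con 0ℤ :+ X :* (con 1ℤ :+ X :* con 0ℤ) := X) refl x

    ⟦2X⟧ : ⟦ + 2 ·ᴾ Xᴾ ⟧ᴾ ≈ (1# + 1#) * x
    ⟦2X⟧ = trans (⟦·ᴾ⟧ (+ 2) Xᴾ) (*-congˡ ⟦Xᴾ⟧)

    ⟦X-1⟧ : ⟦ Xᴾ +ᴾ constᴾ -1ℤ ⟧ᴾ ≈ x - 1#
    ⟦X-1⟧ = trans (⟦+ᴾ⟧ Xᴾ (constᴾ -1ℤ)) (+-cong ⟦Xᴾ⟧ (⟦constᴾ⟧ -1ℤ))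

    ⟦indicatorᴾ⟧ : ∀ b → ⟦ indicatorᴾ b ⟧ᴾ ≈ (if b then 1# else 0#)
    ⟦indicatorᴾ⟧ true  = ⟦constᴾ⟧ 1ℤ
    ⟦indicatorᴾ⟧ false = refl

    ≟0ᴾ : ∀ p → Maybe (⟦ p ⟧ᴾ ≈ 0#)
    ≟0ᴾ []      = just refl
    ≟0ᴾ (a ∷ p) = zipWith (λ a≡0 p≈0 → trans (+-cong (reflexive (cong ⟦_⟧ℤ a≡0)) (*-congˡ p≈0))
                                              (trans (+-identityˡ _) (zeroʳ x)))
                          (dec⇒maybe (a ℤₚ.≟ 0ℤ)) (≟0ᴾ p)

    _≟ᴾ_ : ∀ p q → Maybe (⟦ p ⟧ᴾ ≈ ⟦ q ⟧ᴾ)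
    []      ≟ᴾ q       = map sym (≟0ᴾ q)
    (a ∷ p) ≟ᴾ []      = ≟0ᴾ (a ∷ p)
    (a ∷ p) ≟ᴾ (b ∷ q) = zipWith (λ a≡b p≈q → +-cong (reflexive (cong ⟦_⟧ℤ a≡b)) (*-congˡ p≈q))
                                 (dec⇒maybe (a ℤₚ.≟ b)) (p ≟ᴾ q)

forAll : {A : Set} {P : A → Set} → (∀ a → Maybe (P a)) → ∀ as → Maybe (All P as)
forAll m as = All.sequenceA 0ℓ applicative (All.universal m as)

commutativeRing : Reals → CommutativeRing 0ℓ 0ℓ
commutativeRing ℝ = record { isCommutativeRing = Reals.isCommutativeRing ℝ }

module OrderedField (ℝ : Reals) where
  open Reals ℝ
  open CommutativeRing (commutativeRing ℝ)
    using (+-identityˡ; +-comm; -‿inverseʳ; *-identityˡ; +-group)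
  open IsTotalOrder isTotalOrder using (total; antisym) renaming (refl to ≤-refl; trans to ≤-trans)
  open import Algebra.Properties.Group +-group using (x∙y⁻¹≈ε⇒x≈y)
  open IntegerCoefficients (commutativeRing ℝ) using (solve; _:=_; _:+_; _:*_; _:-_; :-_; con)
  open ≡.≡-Reasoning

  0≤1 : 0# ≤ 1#
  0≤1 with total 0# 1#
  ... | inj₁ p   = p
  ... | inj₂ 1≤0 = subst (0# ≤_) (solve 0 (:- con 1ℤ :* :- con 1ℤ := con 1ℤ) ≡.refl) (*-nonneg _ _ 0≤-1 0≤-1)
    where
    0≤-1 : 0# ≤ - 1#
    0≤-1 = subst₂ _≤_ (-‿inverseʳ 1#) (+-identityˡ (- 1#)) (+-mono-≤ 1# 0# (- 1#) 1≤0)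

  1≤1+ : ∀ {x} → 0# ≤ x → 1# ≤ 1# + x
  1≤1+ {x} 0≤x = subst₂ _≤_ (+-identityˡ 1#) (+-comm x 1#) (+-mono-≤ 0# x 1# 0≤x)

  0≤fromℕ : ∀ n → 0# ≤ fromℕ ℝ n
  0≤fromℕ zero    = ≤-refl
  0≤fromℕ (suc n) = ≤-trans 0≤1 (1≤1+ (0≤fromℕ n))

  fromℕ-nonZero : ∀ {n} → n ℕ.≥ 1 → fromℕ ℝ n ≢ 0#
  fromℕ-nonZero {suc n} _ eq = 0≢1 (antisym 0≤1 (subst (1# ≤_) eq (1≤1+ (0≤fromℕ n))))

  *-cancelˡ-≢0 : ∀ {x y z} → x ≢ 0# → x * y ≡ x * z → y ≡ z
  *-cancelˡ-≢0 {x} {y} {z} x≢0 xy≡xz with inverse x x≢0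
  ... | x⁻¹ , xx⁻¹≡1 = begin
    y                 ≡⟨ solve 2 (λ y i → y := con 1ℤ :* y) ≡.refl y x⁻¹ ⟩
    1# * y            ≡⟨ cong (_* y) xx⁻¹≡1 ⟨
    (x * x⁻¹) * y     ≡⟨ solve 3 (λ x i y → (x :* i) :* y := i :* (x :* y)) ≡.refl x x⁻¹ y ⟩
    x⁻¹ * (x * y)     ≡⟨ cong (x⁻¹ *_) xy≡xz ⟩
    x⁻¹ * (x * z)     ≡⟨ solve 3 (λ x i z → i :* (x :* z) := (x :* i) :* z) ≡.refl x x⁻¹ z ⟩
    (x * x⁻¹) * z     ≡⟨ cong (_* z) xx⁻¹≡1 ⟩
    1# * z            ≡⟨ *-identityˡ z ⟩
    z                 ∎

  x-y≡z⇒x≡z+y : ∀ {x y z} → x + - y ≡ z → x ≡ z + y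
  x-y≡z⇒x≡z+y {x} {y} x-y≡z = begin
    x              ≡⟨ solve 2 (λ x y → x := (x :- y) :+ y) ≡.refl x y ⟩
    (x + - y) + y  ≡⟨ cong (_+ y) x-y≡z ⟩
    _              ∎

  vieta : ∀ {r s α β} → r ≢ s → r * r ≡ α + β * r → s * s ≡ α + β * s →
          β ≡ r + s × α ≡ - (r * s)
  vieta {r} {s} {α} {β} r≢s r-root s-root = β≡r+s , α≡-rs
    where
    factored : (r + - s) * ((r + s) + - β) ≡ (r + - s) * 0#
    factored = begin
      (r + - s) * ((r + s) + - β)
        ≡⟨ solve 3 (λ r s β → (r :- s) :* ((r :+ s) :- β) := (r :* r :- β :* r) :- (s :* s :- β :* s))
                   ≡.refl r s β ⟩
      (r * r + - (β * r)) + - (s * s + - (β * s))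
        ≡⟨ cong₂ (λ u v → (u + - (β * r)) + - (v + - (β * s))) r-root s-root ⟩
      ((α + β * r) + - (β * r)) + - ((α + β * s) + - (β * s))
        ≡⟨ solve 5 (λ r s α β z → ((α :+ β :* r) :- β :* r) :- ((α :+ β :* s) :- β :* s) := (r :- s) :* con 0ℤ)
                   ≡.refl r s α β 0# ⟩
      (r + - s) * 0# ∎
    β≡r+s : β ≡ r + s
    β≡r+s = ≡.sym (x∙y⁻¹≈ε⇒x≈y _ _ (*-cancelˡ-≢0 (r≢s ∘ x∙y⁻¹≈ε⇒x≈y r s) factored))
    α≡-rs : α ≡ - (r * s)
    α≡-rs = begin
      α                        ≡⟨ solve 3 (λ r α β → α := (α :+ β :* r) :- β :* r) ≡.refl r α β ⟩
      (α + β * r) + - (β * r)  ≡⟨ cong (λ u → u + - (β * r)) r-root ⟨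
      r * r + - (β * r)        ≡⟨ cong (λ u → r * r + - (u * r)) β≡r+s ⟩
      r * r + - ((r + s) * r)  ≡⟨ solve 2 (λ r s → r :* r :- (r :+ s) :* r := :- (r :* s)) ≡.refl r s ⟩
      - (r * s)                ∎

pattern 𝟏 = suc zero
pattern 𝟐 = suc (suc zero)

module Notation (ℝ : Reals) (𝒜 : TableAlgebra3 ℝ) where
  open Reals ℝ using (R)

  sum3 : (Fin 3 → R) → R
  sum3 = Defs.sum3 ℝ

  row : R → Fin 3 → R
  row = Defs.row ℝ 𝒜

  IsCharacter : (Fin 3 → R) → Set
  IsCharacter = Defs.IsCharacter ℝ 𝒜

  Vec9 : Set
  Vec9 = Defs.Vec9 ℝ 𝒜

  infixl 7 _⊙_
  _⊙_ : Vec9 → Vec9 → Vec9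
  _⊙_ = Defs._⊙_ ℝ 𝒜

  label : Fin 3 → Fin 3 → ℕ
  label = Defs.label ℝ 𝒜

  blockSum : List ℕ → Vec9
  blockSum = Defs.blockSum ℝ 𝒜

  InSpan : List Vec9 → Vec9 → Set
  InSpan = Defs.InSpan ℝ 𝒜

  spanning : List (List ℕ) → List Vec9
  spanning = Defs.spanning ℝ 𝒜

module Characters (ℝ : Reals) (𝒜 : TableAlgebra3 ℝ) where
  open Reals ℝ
  open TableAlgebra3 𝒜
  open Notation ℝ 𝒜
  open OrderedField ℝ
  open CommutativeRing (commutativeRing ℝ) using (+-identityʳ; +-group)
  open import Algebra.Properties.Group +-group using (x≈y⇒x∙y⁻¹≈ε)
  open IntegerCoefficients (commutativeRing ℝ) using (solve; _:=_; _:+_; _:*_; _:-_; :-_; con)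
  open ≡.≡-Reasoning

  valency₀ : fromℕ ℝ (δ zero) ≡ 1#
  valency₀ = *-cancelˡ-≢0 (fromℕ-nonZero (δ-pos zero)) (begin
    d₀ * d₀                                                      ≡⟨ δ-hom zero zero ⟩
    λc zero zero zero * d₀ + (λc zero zero 𝟏 * d₁ + λc zero zero 𝟐 * d₂)
      ≡⟨ cong₂ (λ u v → u * d₀ + v) (unit zero zero)
               (cong₂ (λ u v → u * d₁ + v * d₂) (unit zero 𝟏) (unit zero 𝟐)) ⟩
    1# * d₀ + (0# * d₁ + 0# * d₂)
      ≡⟨ solve 3 (λ d₀ d₁ d₂ → con 1ℤ :* d₀ :+ (con 0ℤ :* d₁ :+ con 0ℤ :* d₂) := d₀ :* con 1ℤ)
                 ≡.refl d₀ d₁ d₂ ⟩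
    d₀ * 1#                                                      ∎)
    where
    d₀ d₁ d₂ : R
    d₀ = fromℕ ℝ (δ zero)
    d₁ = fromℕ ℝ (δ 𝟏)
    d₂ = fromℕ ℝ (δ 𝟐)

  private
    x+[y-y′]≡x : ∀ {x y y′} → y ≡ y′ → x + (y + - y′) ≡ x
    x+[y-y′]≡x {x} y≡y′ = ≡.trans (cong (_+_ x) (x≈y⇒x∙y⁻¹≈ε y≡y′)) (+-identityʳ x)

  -- Each character equation at Aᵢ Aⱼ, rearranged by adding the (zero) difference of its two
  -- sides to a ring identity.
  row-quadratic₁₁ : ∀ x → IsCharacter (row x) →
    x * x ≡ (λc 𝟏 𝟏 zero + - λc 𝟏 𝟏 𝟐) + (λc 𝟏 𝟏 𝟏 + - λc 𝟏 𝟏 𝟐) * x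
  row-quadratic₁₁ x χ = ≡.trans (χ 𝟏 𝟏)
    (solve 4 (λ z a b x → z :* con 1ℤ :+ (a :* x :+ b :* (:- con 1ℤ :- x)) := (z :- b) :+ (a :- b) :* x)
           ≡.refl (λc 𝟏 𝟏 zero) (λc 𝟏 𝟏 𝟏) (λc 𝟏 𝟏 𝟐) x)

  row-quadratic₁₂ : ∀ x → IsCharacter (row x) →
    x * x ≡ λc 𝟏 𝟐 𝟐 + (λc 𝟏 𝟐 𝟐 + - (λc 𝟏 𝟐 𝟏 + 1#)) * x
  row-quadratic₁₂ x χ = begin
    x * x
      ≡⟨ solve 4 (λ z c d x → x :* x :=
                   (d :+ (d :- (c :+ con 1ℤ)) :* x
                     :+ ((z :* con 1ℤ :+ (c :* x :+ d :* (:- con 1ℤ :- x))) :- x :* (:- con 1ℤ :- x)))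
                   :- z :* con 1ℤ)
               ≡.refl z (λc 𝟏 𝟐 𝟏) α x ⟩
    (α + β * x + (sum3 (λ h → λc 𝟏 𝟐 h * row x h) + - (x * row x 𝟐))) + - (z * 1#)
      ≡⟨ cong₂ (λ u v → u + - (v * 1#)) (x+[y-y′]≡x (≡.sym (χ 𝟏 𝟐))) (off-diag 𝟏 𝟐 λ ()) ⟩
    (α + β * x) + - (0# * 1#)
      ≡⟨ solve 2 (λ α βx → (α :+ βx) :- con 0ℤ :* con 1ℤ := α :+ βx) ≡.refl α (β * x) ⟩
    α + β * x ∎
    where
    z α β : R
    z = λc 𝟏 𝟐 zero
    α = λc 𝟏 𝟐 𝟐
    β = λc 𝟏 𝟐 𝟐 + - (λc 𝟏 𝟐 𝟏 + 1#)

  row-quadratic₂₂ : ∀ x → IsCharacter (row x) →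
    x * x ≡ (λc 𝟐 𝟐 zero + - (λc 𝟐 𝟐 𝟐 + 1#)) + (λc 𝟐 𝟐 𝟏 + - (λc 𝟐 𝟐 𝟐 + (1# + 1#))) * x
  row-quadratic₂₂ x χ = begin
    x * x
      ≡⟨ solve 4 (λ z e f x → x :* x :=
                   (z :- (f :+ con 1ℤ)) :+ (e :- (f :+ con (+ 2))) :* x
                     :+ ((:- con 1ℤ :- x) :* (:- con 1ℤ :- x) :- (z :* con 1ℤ :+ (e :* x :+ f :* (:- con 1ℤ :- x)))))
               ≡.refl (λc 𝟐 𝟐 zero) (λc 𝟐 𝟐 𝟏) (λc 𝟐 𝟐 𝟐) x ⟩
    α + β * x + (row x 𝟐 * row x 𝟐 + - sum3 (λ h → λc 𝟐 𝟐 h * row x h))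
      ≡⟨ x+[y-y′]≡x (χ 𝟐 𝟐) ⟩
    α + β * x ∎
    where
    α β : R
    α = λc 𝟐 𝟐 zero + - (λc 𝟐 𝟐 𝟐 + 1#)
    β = λc 𝟐 𝟐 𝟏 + - (λc 𝟐 𝟐 𝟐 + (1# + 1#))

module Spans (ℝ : Reals) (𝒜 : TableAlgebra3 ℝ) where
  open Reals ℝ
  open TableAlgebra3 𝒜 using (λc)
  open Notation ℝ 𝒜
  open import Algebra.Properties.Ring (CommutativeRing.ring (commutativeRing ℝ)) using (x+x≈x⇒x≈0)
  open IntegerCoefficients (commutativeRing ℝ) using (solve; _:=_; _:+_; _:*_; _:-_; :-_; con)
  open ≡.≡-Reasoning

  infix  4 _≗₉_
  infixl 6 _+₉_
  infixl 7 _·₉_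

  _≗₉_ : Vec9 → Vec9 → Set
  u ≗₉ v = ∀ i j → u i j ≡ v i j

  _+₉_ : Vec9 → Vec9 → Vec9
  (u +₉ v) i j = u i j + v i j

  _·₉_ : R → Vec9 → Vec9
  (c ·₉ u) i j = c * u i j

  0₉ : Vec9
  0₉ i j = 0#

  sum3-cong : ∀ {f g} → (∀ i → f i ≡ g i) → sum3 f ≡ sum3 g
  sum3-cong f≗g = cong₂ _+_ (f≗g zero) (cong₂ _+_ (f≗g 𝟏) (f≗g 𝟐))

  sum3-linear : ∀ c {F f g} → (∀ i → F i ≡ c * f i + g i) → sum3 F ≡ c * sum3 f + sum3 g
  sum3-linear c {f = f} {g} F≗cf+g = ≡.trans (sum3-cong F≗cf+g)
    (solve 7 (λ c a b d x y z → (c :* a :+ x) :+ ((c :* b :+ y) :+ (c :* d :+ z))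
                                := c :* (a :+ (b :+ d)) :+ (x :+ (y :+ z)))
           ≡.refl c (f zero) (f 𝟏) (f 𝟐) (g zero) (g 𝟏) (g 𝟐))

  ⊙-cong : ∀ {u u′ v v′} → u ≗₉ u′ → v ≗₉ v′ → u ⊙ v ≗₉ u′ ⊙ v′
  ⊙-cong u≗u′ v≗v′ h h′ =
    sum3-cong λ i → sum3-cong λ j → sum3-cong λ i′ → sum3-cong λ j′ →
      cong (λ t → t * (λc i i′ h * λc j j′ h′)) (cong₂ _*_ (u≗u′ i j) (v≗v′ i′ j′))

  ⊙-linearˡ : ∀ c u v y → (c ·₉ u +₉ v) ⊙ y ≗₉ c ·₉ (u ⊙ y) +₉ v ⊙ y
  ⊙-linearˡ c u v y h h′ =
    sum3-linear c λ i → sum3-linear c λ j → sum3-linear c λ i′ → sum3-linear c λ j′ →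
      solve 5 (λ c u v y m → (c :* u :+ v) :* y :* m := c :* (u :* y :* m) :+ v :* y :* m)
            ≡.refl c (u i j) (v i j) (y i′ j′) (λc i i′ h * λc j j′ h′)

  ⊙-linearʳ : ∀ c u v x → x ⊙ (c ·₉ u +₉ v) ≗₉ c ·₉ (x ⊙ u) +₉ x ⊙ v
  ⊙-linearʳ c u v x h h′ =
    sum3-linear c λ i → sum3-linear c λ j → sum3-linear c λ i′ → sum3-linear c λ j′ →
      solve 5 (λ c u v x m → x :* (c :* u :+ v) :* m := c :* (x :* u :* m) :+ x :* v :* m)
            ≡.refl c (u i′ j′) (v i′ j′) (x i j) (λc i i′ h * λc j j′ h′)

  record IsLinear (f : Vec9 → Vec9) : Set where
    field
      ≗-cong : ∀ {u v} → u ≗₉ v → f u ≗₉ f v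
      linear : ∀ c u v → f (c ·₉ u +₉ v) ≗₉ c ·₉ f u +₉ f v

    preserves-0 : ∀ {u} → u ≗₉ 0₉ → f u ≗₉ 0₉
    preserves-0 {u} u≗0 i j = x+x≈x⇒x≈0 (f u i j) (begin
      f u i j + f u i j              ≡⟨ solve 1 (λ y → y :+ y := con 1ℤ :* y :+ y) ≡.refl (f u i j) ⟩
      1# * f u i j + f u i j         ≡⟨ linear 1# u u i j ⟨
      f (1# ·₉ u +₉ u) i j           ≡⟨ ≗-cong 1u+u≗u i j ⟩
      f u i j                        ∎)
      where
      1u+u≗u : 1# ·₉ u +₉ u ≗₉ u
      1u+u≗u i j = begin
        1# * u i j + u i j  ≡⟨ cong₂ (λ a b → 1# * a + b) (u≗0 i j) (u≗0 i j) ⟩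
        1# * 0# + 0#        ≡⟨ solve 0 (con 1ℤ :* con 0ℤ :+ con 0ℤ := con 0ℤ) ≡.refl ⟩
        0#                  ≡⟨ u≗0 i j ⟨
        u i j               ∎

  open IsLinear

  ⊙-isLinearˡ : ∀ y → IsLinear (_⊙ y)
  ⊙-isLinearˡ y = record
    { ≗-cong = λ u≗v → ⊙-cong {v = y} u≗v (λ _ _ → ≡.refl)
    ; linear = λ c u v → ⊙-linearˡ c u v y
    }

  ⊙-isLinearʳ : ∀ x → IsLinear (x ⊙_)
  ⊙-isLinearʳ x = record
    { ≗-cong = ⊙-cong {u = x} (λ _ _ → ≡.refl)
    ; linear = λ c u v → ⊙-linearʳ c u v x
    }

  InSpan-resp : ∀ ws {v v′} → v ≗₉ v′ → InSpan ws v → InSpan ws v′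
  InSpan-resp []       v≗v′ v≗0       i j = ≡.trans (≡.sym (v≗v′ i j)) (v≗0 i j)
  InSpan-resp (w ∷ ws) v≗v′ (c , rest)    =
    c , InSpan-resp ws (λ i j → cong (λ t → t + - (c * w i j)) (v≗v′ i j)) rest

  InSpan-zero : ∀ ws {v} → v ≗₉ 0₉ → InSpan ws v
  InSpan-zero []       v≗0 = v≗0
  InSpan-zero (w ∷ ws) v≗0 = 0# , InSpan-zero ws λ i j →
    ≡.trans (cong (λ t → t + - (0# * w i j)) (v≗0 i j))
            (solve 1 (λ w → con 0ℤ :- con 0ℤ :* w := con 0ℤ) ≡.refl (w i j))

  InSpan-linear : ∀ ws c {u v} → InSpan ws u → InSpan ws v → InSpan ws (c ·₉ u +₉ v)
  InSpan-linear []       c u≗0 v≗0 i j =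
    ≡.trans (cong₂ (λ a b → c * a + b) (u≗0 i j) (v≗0 i j))
            (solve 1 (λ c → c :* con 0ℤ :+ con 0ℤ := con 0ℤ) ≡.refl c)
  InSpan-linear (w ∷ ws) c {u} {v} (a , u′) (b , v′) = c * a + b , InSpan-resp ws
    (λ i j → solve 6 (λ c a b u v w → c :* (u :- a :* w) :+ (v :- b :* w)
                                      := (c :* u :+ v) :- (c :* a :+ b) :* w)
                     ≡.refl c a b (u i j) (v i j) (w i j))
    (InSpan-linear ws c u′ v′)

  InSpan-map : ∀ {f} → IsLinear f → ∀ S ws → All (λ w → InSpan S (f w)) ws →
               ∀ {x} → InSpan ws x → InSpan S (f x)
  InSpan-map f-lin S []       []           x≗0         = InSpan-zero S (preserves-0 f-lin x≗0)
  InSpan-map {f} f-lin S (w ∷ ws) (fw∈S ∷ fws∈S) {x} (c , x′∈ws) =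
    InSpan-resp S f-decomposition (InSpan-linear S c fw∈S (InSpan-map f-lin S ws fws∈S x′∈ws))
    where
    x′ : Vec9
    x′ i j = x i j + - (c * w i j)
    f-decomposition : c ·₉ f w +₉ f x′ ≗₉ f x
    f-decomposition i j = ≡.trans (≡.sym (linear f-lin c w x′ i j))
      (≗-cong f-lin (λ i j → solve 3 (λ c w x → c :* w :+ (x :- c :* w) := x) ≡.refl c (w i j) (x i j)) i j)

  InSpan-⊙-closed : ∀ S → All (λ w → All (λ w′ → InSpan S (w ⊙ w′)) S) S →
                    ∀ x y → InSpan S x → InSpan S y → InSpan S (x ⊙ y)
  InSpan-⊙-closed S products x y x∈S y∈S =
    InSpan-map (⊙-isLinearˡ y) S S
      (All.map (λ {w} w⊙S⊆S → InSpan-map (⊙-isLinearʳ w) S S w⊙S⊆S y∈S) products) x∈S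

  blockCombination : (List ℕ → R) → List (List ℕ) → Vec9
  blockCombination c []      i j = 0#
  blockCombination c (T ∷ τ) i j = c T * blockSum T i j + blockCombination c τ i j

  InSpan-blockCombination : ∀ c τ → InSpan (spanning τ) (blockCombination c τ)
  InSpan-blockCombination c []      i j = ≡.refl
  InSpan-blockCombination c (T ∷ τ)     = c T , InSpan-resp (spanning τ)
    (λ i j → solve 3 (λ a e v → v := (a :* e :+ v) :- a :* e)
                     ≡.refl (c T) (blockSum T i j) (blockCombination c τ i j))
    (InSpan-blockCombination c τ)

  All-spanning : ∀ {P : Vec9 → Set} τ → All (P ∘ blockSum) τ → All P (spanning τ)
  All-spanning []      []       = []
  All-spanning (T ∷ τ) (p ∷ ps) = p ∷ All-spanning τ ps

module SymbolicTensorSquare (ℝ : Reals) (𝒜 : TableAlgebra3 ℝ) (x : Reals.R ℝ)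
  (Λ : Fin 3 → Fin 3 → Fin 3 → Poly)
  (λc≡⟦Λ⟧ : ∀ i j h → TableAlgebra3.λc 𝒜 i j h ≡
                      IntegerCoefficients.Evaluation.⟦_⟧ᴾ (commutativeRing ℝ) x (Λ i j h)) where
  open Reals ℝ
  open TableAlgebra3 𝒜 using (λc)
  open Notation ℝ 𝒜
  open Spans ℝ 𝒜
  open IntegerCoefficients (commutativeRing ℝ) using (module Evaluation)
  open Evaluation x
  open ≡.≡-Reasoning

  Vec9ᴾ : Set
  Vec9ᴾ = Fin 3 → Fin 3 → Poly

  ⟦_⟧₉ : Vec9ᴾ → Vec9
  ⟦ V ⟧₉ i j = ⟦ V i j ⟧ᴾ

  sum3ᴾ : (Fin 3 → Poly) → Poly
  sum3ᴾ f = f zero +ᴾ (f 𝟏 +ᴾ f 𝟐)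

  infixl 7 _⊙ᴾ_
  _⊙ᴾ_ : Vec9ᴾ → Vec9ᴾ → Vec9ᴾ
  (X ⊙ᴾ Y) h h′ = sum3ᴾ λ i → sum3ᴾ λ j → sum3ᴾ λ i′ → sum3ᴾ λ j′ →
                    X i j *ᴾ Y i′ j′ *ᴾ (Λ i i′ h *ᴾ Λ j j′ h′)

  ⟦sum3ᴾ⟧ : ∀ f {g} → (∀ i → ⟦ f i ⟧ᴾ ≡ g i) → ⟦ sum3ᴾ f ⟧ᴾ ≡ sum3 g
  ⟦sum3ᴾ⟧ f f≗g = ≡.trans (≡.trans (⟦+ᴾ⟧ (f zero) _) (cong (_+_ ⟦ f zero ⟧ᴾ) (⟦+ᴾ⟧ (f 𝟏) (f 𝟐))))
                          (sum3-cong f≗g)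

  ⟦⊙ᴾ⟧ : ∀ {X Y u v} → ⟦ X ⟧₉ ≗₉ u → ⟦ Y ⟧₉ ≗₉ v → ⟦ X ⊙ᴾ Y ⟧₉ ≗₉ u ⊙ v
  ⟦⊙ᴾ⟧ {X} {Y} {u} {v} X≗u Y≗v h h′ =
    ⟦sum3ᴾ⟧ (λ i → sum3ᴾ λ j → sum3ᴾ λ i′ → sum3ᴾ λ j′ → summand i j i′ j′) λ i →
    ⟦sum3ᴾ⟧ (λ j → sum3ᴾ λ i′ → sum3ᴾ λ j′ → summand i j i′ j′) λ j →
    ⟦sum3ᴾ⟧ (λ i′ → sum3ᴾ λ j′ → summand i j i′ j′) λ i′ →
    ⟦sum3ᴾ⟧ (λ j′ → summand i j i′ j′) λ j′ → ⟦summand⟧ i j i′ j′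
    where
    summand : Fin 3 → Fin 3 → Fin 3 → Fin 3 → Poly
    summand i j i′ j′ = X i j *ᴾ Y i′ j′ *ᴾ (Λ i i′ h *ᴾ Λ j j′ h′)
    ⟦summand⟧ : ∀ i j i′ j′ → ⟦ summand i j i′ j′ ⟧ᴾ ≡ u i j * v i′ j′ * (λc i i′ h * λc j j′ h′)
    ⟦summand⟧ i j i′ j′ = begin
      ⟦ X i j *ᴾ Y i′ j′ *ᴾ (Λ i i′ h *ᴾ Λ j j′ h′) ⟧ᴾ
        ≡⟨ ≡.trans (⟦*ᴾ⟧ (X i j *ᴾ Y i′ j′) (Λ i i′ h *ᴾ Λ j j′ h′))
                   (cong₂ _*_ (⟦*ᴾ⟧ (X i j) (Y i′ j′)) (⟦*ᴾ⟧ (Λ i i′ h) (Λ j j′ h′))) ⟩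
      ⟦ X i j ⟧ᴾ * ⟦ Y i′ j′ ⟧ᴾ * (⟦ Λ i i′ h ⟧ᴾ * ⟦ Λ j j′ h′ ⟧ᴾ)
        ≡⟨ cong₂ _*_ (cong₂ _*_ (X≗u i j) (Y≗v i′ j′))
                     (≡.sym (cong₂ _*_ (λc≡⟦Λ⟧ i i′ h) (λc≡⟦Λ⟧ j j′ h′))) ⟩
      u i j * v i′ j′ * (λc i i′ h * λc j j′ h′) ∎

  blockSumᴾ : List ℕ → Vec9ᴾ
  blockSumᴾ T i j = indicatorᴾ (any (λ t → t ℕ.≡ᵇ label i j) T)

  ⟦blockSumᴾ⟧ : ∀ T → ⟦ blockSumᴾ T ⟧₉ ≗₉ blockSum T
  ⟦blockSumᴾ⟧ T i j = ⟦indicatorᴾ⟧ (any (λ t → t ℕ.≡ᵇ label i j) T)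

  -- The coefficient of a block is read off at the cell of its first label; InSpan? checks
  -- that the resulting decomposition is correct, so the fallback cell is harmless.
  cellOf : ℕ → Fin 3 × Fin 3
  cellOf 2 = 𝟏 , zero
  cellOf 3 = 𝟐 , zero
  cellOf 4 = zero , 𝟏
  cellOf 5 = 𝟏 , 𝟏
  cellOf 6 = 𝟐 , 𝟏
  cellOf 7 = zero , 𝟐
  cellOf 8 = 𝟏 , 𝟐
  cellOf 9 = 𝟐 , 𝟐
  cellOf _ = zero , zero

  coefficient : Vec9ᴾ → List ℕ → Poly
  coefficient V []      = []
  coefficient V (t ∷ _) = V (proj₁ (cellOf t)) (proj₂ (cellOf t))

  expand : Vec9ᴾ → List (List ℕ) → Vec9ᴾ
  expand V []      i j = []
  expand V (T ∷ τ) i j = coefficient V T *ᴾ blockSumᴾ T i j +ᴾ expand V τ i j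

  ⟦expand⟧ : ∀ V τ → ⟦ expand V τ ⟧₉ ≗₉ blockCombination (λ T → ⟦ coefficient V T ⟧ᴾ) τ
  ⟦expand⟧ V []      i j = ≡.refl
  ⟦expand⟧ V (T ∷ τ) i j = ≡.trans (⟦+ᴾ⟧ (coefficient V T *ᴾ blockSumᴾ T i j) (expand V τ i j))
    (cong₂ _+_ (≡.trans (⟦*ᴾ⟧ (coefficient V T) (blockSumᴾ T i j))
                        (cong (⟦ coefficient V T ⟧ᴾ *_) (⟦blockSumᴾ⟧ T i j)))
               (⟦expand⟧ V τ i j))

  InSpan? : ∀ V τ → Maybe (InSpan (spanning τ) ⟦ V ⟧₉)
  InSpan? V τ = map
    (λ V≗expand → InSpan-resp (spanning τ) (λ i j → ≡.sym (≡.trans (V≗expand i j) (⟦expand⟧ V τ i j)))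
                                           (InSpan-blockCombination _ τ))
    (sequence applicative λ i → sequence applicative λ j → V i j ≟ᴾ expand V τ i j)

  fusion? : ∀ τ → Maybe (IsFusion ℝ 𝒜 τ)
  fusion? τ =
    map (λ products → InSpan-⊙-closed (spanning τ₁) (All-spanning τ₁ (All.map (All-spanning τ₁) products)))
        (forAll (λ T → forAll (λ T′ → product∈span? T T′) τ₁) τ₁)
    where
    τ₁ : List (List ℕ)
    τ₁ = (1 ∷ []) ∷ τ
    product∈span? : ∀ T T′ → Maybe (InSpan (spanning τ₁) (blockSum T ⊙ blockSum T′))
    product∈span? T T′ =
      map (InSpan-resp (spanning τ₁) (⟦⊙ᴾ⟧ {blockSumᴾ T} {blockSumᴾ T′} (⟦blockSumᴾ⟧ T) (⟦blockSumᴾ⟧ T′)))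
          (InSpan? (blockSumᴾ T ⊙ᴾ blockSumᴾ T′) τ₁)

-- The structure constants found in StructureConstants, with Xᴾ standing for q = r + r².
λᴾ : Fin 3 → Fin 3 → Fin 3 → Poly
λᴾ zero    j    h    = indicatorᴾ (toℕ j ℕ.≡ᵇ toℕ h)
λᴾ (suc i) zero h    = indicatorᴾ (toℕ (suc i) ℕ.≡ᵇ toℕ h)
λᴾ 𝟏       𝟏    zero = + 2 ·ᴾ Xᴾ
λᴾ 𝟏       𝟏    𝟏    = Xᴾ +ᴾ constᴾ -1ℤ
λᴾ 𝟏       𝟏    𝟐    = Xᴾ
λᴾ 𝟏       𝟐    zero = []
λᴾ 𝟏       𝟐    𝟏    = Xᴾ
λᴾ 𝟏       𝟐    𝟐    = Xᴾ
λᴾ 𝟐       𝟏    zero = []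
λᴾ 𝟐       𝟏    𝟏    = Xᴾ
λᴾ 𝟐       𝟏    𝟐    = Xᴾ
λᴾ 𝟐       𝟐    zero = + 2 ·ᴾ Xᴾ
λᴾ 𝟐       𝟐    𝟏    = Xᴾ
λᴾ 𝟐       𝟐    𝟐    = Xᴾ +ᴾ constᴾ -1ℤ

module StructureConstants (ℝ : Reals) (𝒜 : TableAlgebra3 ℝ) (r : Reals.R ℝ)
  (χ : HasCharTable ℝ 𝒜 r (Reals._+_ ℝ (Reals.-_ ℝ (Reals.1# ℝ)) (Reals.-_ ℝ r)))
  (k≡ℓ : TableAlgebra3.δ 𝒜 𝟏 ≡ TableAlgebra3.δ 𝒜 𝟐) where
  open Reals ℝ
  open TableAlgebra3 𝒜
  open Notation ℝ 𝒜
  open OrderedField ℝ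
  open Characters ℝ 𝒜
  open CommutativeRing (commutativeRing ℝ) using (+-comm; +-identityʳ)
  open IntegerCoefficients (commutativeRing ℝ) using (solve; _:=_; _:+_; _:*_; _:-_; :-_; con; module Evaluation)
  open ≡.≡-Reasoning

  q k : R
  q = r + r * r
  k = fromℕ ℝ (δ 𝟏)

  roots : ∀ {α β} → (∀ x → IsCharacter (row x) → x * x ≡ α + β * x) → β ≡ - 1# × α ≡ q
  roots quadratic =
    let χr , χs , r≢s = χ
        β≡r+s , α≡-rs = vieta r≢s (quadratic r χr) (quadratic _ χs)
    in
    ≡.trans β≡r+s (solve 1 (λ r → r :+ (:- con 1ℤ :- r) := :- con 1ℤ) ≡.refl r) ,
    ≡.trans α≡-rs (solve 1 (λ r → :- (r :* (:- con 1ℤ :- r)) := r :+ r :* r) ≡.refl r)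

  λ₁₁₀≡k : λc 𝟏 𝟏 zero ≡ k
  λ₁₁₀≡k = standard 𝟏

  ℓ≡k : fromℕ ℝ (δ 𝟐) ≡ k
  ℓ≡k = cong (fromℕ ℝ) (≡.sym k≡ℓ)

  k≡1+λ₁₁₁+λ₁₁₂ : k ≡ 1# + λc 𝟏 𝟏 𝟏 + λc 𝟏 𝟏 𝟐
  k≡1+λ₁₁₁+λ₁₁₂ = *-cancelˡ-≢0 (fromℕ-nonZero (δ-pos 𝟏)) (begin
    k * k                                                         ≡⟨ δ-hom 𝟏 𝟏 ⟩
    λc 𝟏 𝟏 zero * fromℕ ℝ (δ zero) + (λc 𝟏 𝟏 𝟏 * k + λc 𝟏 𝟏 𝟐 * fromℕ ℝ (δ 𝟐))
      ≡⟨ cong₂ (λ u w → u + (λc 𝟏 𝟏 𝟏 * k + λc 𝟏 𝟏 𝟐 * w)) (cong₂ _*_ λ₁₁₀≡k valency₀) ℓ≡k ⟩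
    k * 1# + (λc 𝟏 𝟏 𝟏 * k + λc 𝟏 𝟏 𝟐 * k)
      ≡⟨ solve 3 (λ k a b → k :* con 1ℤ :+ (a :* k :+ b :* k) := k :* (con 1ℤ :+ a :+ b))
                 ≡.refl k (λc 𝟏 𝟏 𝟏) (λc 𝟏 𝟏 𝟐) ⟩
    k * (1# + λc 𝟏 𝟏 𝟏 + λc 𝟏 𝟏 𝟐)                                ∎)

  λ₁₁₁≡λ₁₁₂-1 : λc 𝟏 𝟏 𝟏 ≡ - 1# + λc 𝟏 𝟏 𝟐
  λ₁₁₁≡λ₁₁₂-1 = x-y≡z⇒x≡z+y (proj₁ (roots row-quadratic₁₁))

  λ₁₁₂≡q : λc 𝟏 𝟏 𝟐 ≡ q
  λ₁₁₂≡q = begin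
    b                                ≡⟨ solve 1 (λ b → b := (con 1ℤ :+ (:- con 1ℤ :+ b) :+ b) :- b) ≡.refl b ⟩
    (1# + (- 1# + b) + b) + - b      ≡⟨ cong (λ a → (1# + a + b) + - b) λ₁₁₁≡λ₁₁₂-1 ⟨
    (1# + λc 𝟏 𝟏 𝟏 + b) + - b        ≡⟨ cong (λ t → t + - b) (≡.trans λ₁₁₀≡k k≡1+λ₁₁₁+λ₁₁₂) ⟨
    λc 𝟏 𝟏 zero + - b                ≡⟨ proj₂ (roots row-quadratic₁₁) ⟩
    q                                ∎
    where
    b : R
    b = λc 𝟏 𝟏 𝟐

  λ₁₁₁≡q-1 : λc 𝟏 𝟏 𝟏 ≡ q + - 1#
  λ₁₁₁≡q-1 = ≡.trans λ₁₁₁≡λ₁₁₂-1 (≡.trans (cong (_+_ (- 1#)) λ₁₁₂≡q) (+-comm (- 1#) q))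

  λ₁₁₀≡2q : λc 𝟏 𝟏 zero ≡ (1# + 1#) * q
  λ₁₁₀≡2q = begin
    λc 𝟏 𝟏 zero                   ≡⟨ ≡.trans λ₁₁₀≡k k≡1+λ₁₁₁+λ₁₁₂ ⟩
    1# + λc 𝟏 𝟏 𝟏 + λc 𝟏 𝟏 𝟐      ≡⟨ cong₂ (λ a b → 1# + a + b) λ₁₁₁≡q-1 λ₁₁₂≡q ⟩
    1# + (q + - 1#) + q           ≡⟨ solve 1 (λ q → con 1ℤ :+ (q :- con 1ℤ) :+ q := con (+ 2) :* q) ≡.refl q ⟩
    (1# + 1#) * q                 ∎

  λ₁₂₂≡q : λc 𝟏 𝟐 𝟐 ≡ q
  λ₁₂₂≡q = proj₂ (roots row-quadratic₁₂)

  λ₁₂₁≡q : λc 𝟏 𝟐 𝟏 ≡ q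
  λ₁₂₁≡q = begin
    λc 𝟏 𝟐 𝟏                  ≡⟨ solve 1 (λ c → c := :- con 1ℤ :+ (c :+ con 1ℤ)) ≡.refl (λc 𝟏 𝟐 𝟏) ⟩
    - 1# + (λc 𝟏 𝟐 𝟏 + 1#)    ≡⟨ x-y≡z⇒x≡z+y (proj₁ (roots row-quadratic₁₂)) ⟨
    λc 𝟏 𝟐 𝟐                  ≡⟨ λ₁₂₂≡q ⟩
    q                         ∎

  λ₂₂₀≡2q : λc 𝟐 𝟐 zero ≡ (1# + 1#) * q
  λ₂₂₀≡2q = ≡.trans (standard 𝟐) (≡.trans ℓ≡k (≡.trans (≡.sym λ₁₁₀≡k) λ₁₁₀≡2q))

  λ₂₂₂≡q-1 : λc 𝟐 𝟐 𝟐 ≡ q + - 1#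
  λ₂₂₂≡q-1 = begin
    f                                   ≡⟨ solve 2 (λ q f → f := (q :+ (f :+ con 1ℤ)) :- q :- con 1ℤ) ≡.refl q f ⟩
    (q + (f + 1#)) + - q + - 1#         ≡⟨ cong (λ t → t + - q + - 1#) (x-y≡z⇒x≡z+y (proj₂ (roots row-quadratic₂₂))) ⟨
    λc 𝟐 𝟐 zero + - q + - 1#            ≡⟨ cong (λ t → t + - q + - 1#) λ₂₂₀≡2q ⟩
    (1# + 1#) * q + - q + - 1#          ≡⟨ solve 1 (λ q → con (+ 2) :* q :- q :- con 1ℤ := q :- con 1ℤ) ≡.refl q ⟩
    q + - 1#                            ∎
    where
    f : R
    f = λc 𝟐 𝟐 𝟐

  λ₂₂₁≡q : λc 𝟐 𝟐 𝟏 ≡ q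
  λ₂₂₁≡q = begin
    λc 𝟐 𝟐 𝟏                           ≡⟨ x-y≡z⇒x≡z+y (proj₁ (roots row-quadratic₂₂)) ⟩
    - 1# + (λc 𝟐 𝟐 𝟐 + (1# + 1#))      ≡⟨ cong (λ f → - 1# + (f + (1# + 1#))) λ₂₂₂≡q-1 ⟩
    - 1# + ((q + - 1#) + (1# + 1#))    ≡⟨ solve 1 (λ q → :- con 1ℤ :+ ((q :- con 1ℤ) :+ con (+ 2)) := q) ≡.refl q ⟩
    q                                  ∎

  open Evaluation q

  λc≡⟦λᴾ⟧ : ∀ i j h → λc i j h ≡ ⟦ λᴾ i j h ⟧ᴾ
  λc≡⟦λᴾ⟧ zero    j    h    = ≡.trans (unit j h) (≡.sym (⟦indicatorᴾ⟧ _))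
  λc≡⟦λᴾ⟧ (suc i) zero h    = ≡.trans (comm (suc i) zero h) (λc≡⟦λᴾ⟧ zero (suc i) h)
  λc≡⟦λᴾ⟧ 𝟏       𝟏    zero = ≡.trans λ₁₁₀≡2q (≡.sym ⟦2X⟧)
  λc≡⟦λᴾ⟧ 𝟏       𝟏    𝟏    = ≡.trans λ₁₁₁≡q-1 (≡.sym ⟦X-1⟧)
  λc≡⟦λᴾ⟧ 𝟏       𝟏    𝟐    = ≡.trans λ₁₁₂≡q (≡.sym ⟦Xᴾ⟧)
  λc≡⟦λᴾ⟧ 𝟏       𝟐    zero = off-diag 𝟏 𝟐 λ ()
  λc≡⟦λᴾ⟧ 𝟏       𝟐    𝟏    = ≡.trans λ₁₂₁≡q (≡.sym ⟦Xᴾ⟧)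
  λc≡⟦λᴾ⟧ 𝟏       𝟐    𝟐    = ≡.trans λ₁₂₂≡q (≡.sym ⟦Xᴾ⟧)
  λc≡⟦λᴾ⟧ 𝟐       𝟏    zero = ≡.trans (comm 𝟐 𝟏 zero) (λc≡⟦λᴾ⟧ 𝟏 𝟐 zero)
  λc≡⟦λᴾ⟧ 𝟐       𝟏    𝟏    = ≡.trans (comm 𝟐 𝟏 𝟏) (λc≡⟦λᴾ⟧ 𝟏 𝟐 𝟏)
  λc≡⟦λᴾ⟧ 𝟐       𝟏    𝟐    = ≡.trans (comm 𝟐 𝟏 𝟐) (λc≡⟦λᴾ⟧ 𝟏 𝟐 𝟐)
  λc≡⟦λᴾ⟧ 𝟐       𝟐    zero = ≡.trans λ₂₂₀≡2q (≡.sym ⟦2X⟧)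
  λc≡⟦λᴾ⟧ 𝟐       𝟐    𝟏    = ≡.trans λ₂₂₁≡q (≡.sym ⟦Xᴾ⟧)
  λc≡⟦λᴾ⟧ 𝟐       𝟐    𝟐    = ≡.trans λ₂₂₂≡q-1 (≡.sym ⟦X-1⟧)

  k≡2q : k ≡ fromℕ ℝ 2 * q
  k≡2q = ≡.trans (≡.sym λ₁₁₀≡k)
           (≡.trans λ₁₁₀≡2q (cong (λ t → (1# + t) * q) (≡.sym (+-identityʳ 1#))))

  -- The Maybe evaluates to just during type checking: this is where the 11 fusions are checked.
  fusions : All (IsFusion ℝ 𝒜) paperPartitions
  fusions = from-just (forAll fusion? paperPartitions)
    where open SymbolicTensorSquare ℝ 𝒜 q λᴾ λc≡⟦λᴾ⟧ using (fusion?)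

theorem4p3 : (ℝ : Reals) → (𝒜 : TableAlgebra3 ℝ) → (r s : Reals.R ℝ) →
    HasCharTable ℝ 𝒜 r s →
    TableAlgebra3.δ 𝒜 (suc zero) ≡ TableAlgebra3.δ 𝒜 (suc (suc zero)) →
    s ≡ Reals._+_ ℝ (Reals.-_ ℝ (Reals.1# ℝ)) (Reals.-_ ℝ r) →
    (fromℕ ℝ (TableAlgebra3.δ 𝒜 (suc zero))
       ≡ Reals._*_ ℝ (fromℕ ℝ 2) (Reals._+_ ℝ r (Reals._*_ ℝ r r))
     × fromℕ ℝ (TableAlgebra3.δ 𝒜 (suc (suc zero)))
       ≡ Reals._*_ ℝ (fromℕ ℝ 2) (Reals._+_ ℝ r (Reals._*_ ℝ r r))
     × All (IsFusion ℝ 𝒜) paperPartitions)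
theorem4p3 ℝ 𝒜 r s χ k≡ℓ ≡.refl = k≡2q , ≡.trans ℓ≡k k≡2q , fusions
  where open StructureConstants ℝ 𝒜 r χ k≡ℓ
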